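{- Let $G$ be a quasi $f$-graph of type $(0,b)$ on the vertex set $V=\{v_1,\dots,v_n\}$. Then $$-\binom{n}{2}+2\le b\le \binom{n}{2}-2N(n,2).$$
   Context: Let $k$ be a field and $R=k[x_1,\dots,x_n]$, the variable $x_i$ corresponding to the vertex $v_i$. For $F\subseteq V$ write $x_F=\prod_{v_i\in F}x_i$. For a square-free monomial ideal $I\subseteq R$ with minimal monomial generating set $G(I)$: the facet complex $\delta_{\mathcal F}(I)$ is the simplicial complex whose facets are the sets $\{v_{i_1},\dots,v_{i_r}\}$ with $x_{i_1}\cdots x_{i_r}\in G(I)$; the non-face complex $\delta_{\mathcal N}(I)$ is $\{F\subseteq V : x_F\notin I\}$. The $f$-vector of a $d$-dimensional simplicial complex is $(f_0,\dots,f_d)$, $f_i$ the number of faces with $i+1$ elements. $I$ is a quasi $f$-ideal of type $(a_1,\dots,a_s)\in\mathbb Z^s$ if $f(\delta_{\mathcal N}(I))-f(\delta_{\mathcal F}(I))=(a_1,\dots,a_s)$, both $f$-vectors lying in $\mathbb Z^s$. A finite simple graph $G$ on $V$ is a quasi $f$-graph of type $(0,b)$ if its edge ideal $I(G)=(x_ix_j:\{v_i,v_j\}\in E(G))$ is a quasi $f$-ideal of type $(0,b)$. Perfect numbers: let $sm(R)_d$ denote the set of square-free monomials of degree $d$ in $R$. For $U\subseteq sm(R)_d$ let $\sqcup(U)=\{gx_i : g\in U,\ x_i\nmid g\}$ and $\sqcap(U)=\{g/x_i: g\in U,\ x_i\mid g\}$. $U$ is upper perfect if $\sqcup(U)=sm(R)_{d+1}$,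 lower perfect if $\sqcap(U)=sm(R)_{d-1}$, and perfect if both. $N(n,d)$ is the smallest cardinality of a perfect subset of $sm(R)_d$. -}

module Defs where

open import Data.Bool using (Bool; true; false; not; _∧_; _∨_; if_then_else_)
open import Data.Nat using (ℕ; zero; suc; _⊔_; _≤_)
open import Data.Integer as ℤ using (ℤ)
open import Data.Fin using (Fin; _<_)
open import Data.Fin.Subset using (Subset; ∣_∣; ⁅_⁆; _∪_; _-_; _∈_; _∉_; inside; outside)
open import Data.Vec using (Vec; []; _∷_)
open import Data.List using (List; []; _∷_; map; filter; foldr; length; upTo; zipWith; allFin; concatMap)
open import Data.Product using (Σ; _×_; ∃)
open import Relation.Binary.PropositionalEquality using (_≡_)

record Graph (n : ℕ) : Set where
  field
    adj     : Fin n → Fin n → Bool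
    adj-sym : ∀ i j → adj i j ≡ adj j i
    adj-irr : ∀ i → adj i i ≡ false
open Graph public

-- Square-free monomials x_F of R = k[x_1,…,x_n] are identified with
-- subsets F ⊆ V (Subset n = Vec Bool n).

_⊆ᵇ_ : ∀ {n} → Subset n → Subset n → Bool
[] ⊆ᵇ [] = true
(true ∷ p) ⊆ᵇ (false ∷ q) = false
(_ ∷ p) ⊆ᵇ (_ ∷ q) = p ⊆ᵇ q

boolFilter : ∀ {A : Set} → (A → Bool) → List A → List A
boolFilter p [] = []
boolFilter p (x ∷ xs) = if p x then x ∷ boolFilter p xs else boolFilter p xs

allSubsets : (n : ℕ) → List (Subset n)
allSubsets zero = [] ∷ []
allSubsets (suc n) = map (outside ∷_) (allSubsets n) Data.List.++ map (inside ∷_) (allSubsets n)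

count : ∀ {n} → (Subset n → Bool) → ℕ
count {n} P = length (boolFilter P (allSubsets n))

Complex : ℕ → Set
Complex n = Subset n → Bool

fᵢ : ∀ {n} → Complex n → ℕ → ℕ
fᵢ Δ i = count (λ F → Δ F ∧ (∣ F ∣ Data.Nat.≡ᵇ suc i))

-- maximal number of elements of a face (= dim Δ + 1).
maxFaceSize : ∀ {n} → Complex n → ℕ
maxFaceSize {n} Δ = foldr _⊔_ 0 (map ∣_∣ (boolFilter Δ (allSubsets n)))

fVector : ∀ {n} → Complex n → List ℤ
fVector Δ = map (λ i → ℤ.+ fᵢ Δ i) (upTo (maxFaceSize Δ))

-- Square-free monomial ideals, given by their minimal generating set G(I)
-- (a list of square-free monomials, i.e. subsets).

-- membership of a square-free monomial x_F in I = (G(I)):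
-- x_F ∈ I iff some generator divides x_F.
inIdeal : ∀ {n} → List (Subset n) → Subset n → Bool
inIdeal gens F = foldr _∨_ false (map (λ g → g ⊆ᵇ F) gens)

-- facet complex: facets are the supports of the generators.
facetComplex : ∀ {n} → List (Subset n) → Complex n
facetComplex gens F = foldr _∨_ false (map (λ g → F ⊆ᵇ g) gens)

nonFaceComplex : ∀ {n} → List (Subset n) → Complex n
nonFaceComplex gens F = not (inIdeal gens F)

-- quasi f-ideal of type a : f(δ_N(I)) − f(δ_F(I)) = a, both f-vectors in ℤ^s.
IsQuasiFIdealOfType : ∀ {n} → List (Subset n) → List ℤ → Set
IsQuasiFIdealOfType gens a =
  length (fVector (nonFaceComplex gens)) ≡ length a ×
  length (fVector (facetComplex gens)) ≡ length a ×
  zipWith ℤ._-_ (fVector (nonFaceComplex gens)) (fVector (facetComplex gens)) ≡ a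

-- Edge ideal: G(I(G)) = { x_i x_j : {v_i,v_j} ∈ E(G) }, each edge listed once (i < j).

edgeGens : ∀ {n} → Graph n → List (Subset n)
edgeGens {n} G =
  concatMap (λ i → map (λ j → ⁅ i ⁆ ∪ ⁅ j ⁆)
                       (boolFilter (λ j → adj G i j ∧ (Data.Fin.toℕ i Data.Nat.<ᵇ Data.Fin.toℕ j)) (allFin n)))
            (allFin n)

IsQuasiFGraphOfType0 : ∀ {n} → Graph n → ℤ → Set
IsQuasiFGraphOfType0 G b = IsQuasiFIdealOfType (edgeGens G) (ℤ.+ 0 ∷ b ∷ [])

-- Perfect sets of square-free monomials of degree d.
-- A set U ⊆ sm(R)_d is a decidable predicate on subsets, all of size d.

record SMSet (n d : ℕ) : Set where
  field
    mem    : Subset n → Bool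
    degree : ∀ g → mem g ≡ true → ∣ g ∣ ≡ d
open SMSet public

card : ∀ {n d} → SMSet n d → ℕ
card U = count (mem U)

-- ⊔(U) = sm(R)_{d+1}  (the inclusion ⊔(U) ⊆ sm(R)_{d+1} is automatic)
UpperPerfect : ∀ {n d} → SMSet n d → Set
UpperPerfect {n} {d} U =
  ∀ (h : Subset n) → ∣ h ∣ ≡ suc d →
  Σ (Subset n) λ g → Σ (Fin n) λ i → mem U g ≡ true × i ∉ g × h ≡ g ∪ ⁅ i ⁆

-- ⊓(U) = sm(R)_{d-1}  (the inclusion ⊓(U) ⊆ sm(R)_{d-1} is automatic)
LowerPerfect : ∀ {n d} → SMSet n d → Set
LowerPerfect {n} {d} U =
  ∀ (h : Subset n) → ∣ h ∣ Data.Nat.+ 1 ≡ d →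
  Σ (Subset n) λ g → Σ (Fin n) λ i → mem U g ≡ true × i ∈ g × h ≡ g - i

Perfect : ∀ {n d} → SMSet n d → Set
Perfect U = UpperPerfect U × LowerPerfect U

-- m = N(n,d): the smallest cardinality of a perfect subset of sm(R)_d.
IsN : ℕ → ℕ → ℕ → Set
IsN n d m = (Σ (SMSet n d) λ U → Perfect U × card U ≡ m)
          × (∀ (U : SMSet n d) → Perfect U → m ≤ card U)

-- Only the fact that I(G) is generated in degree 2 matters.  Then the faces of
-- δ_F of size 2 are exactly the generators E, and on 2-sets δ_N is the
-- complement of δ_F, so f₁(δ_N) + |E| = C(n,2) and b = f₁(δ_N) − |E|.  Type (0,b)
-- forces dim δ_N = 1, i.e. every 3-set contains a generator: E is upper perfect.
-- It also forces f₀(δ_F) = f₀(δ_N) = n, i.e. every vertex lies in a generator: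
-- E is lower perfect.  Hence |E| ≥ N(n,2), while f₁(δ_N) ≥ 1 since δ_N has an
-- edge; both bounds follow.
module Submission where

open import Defs
open import Data.Nat using (ℕ)
open import Data.Nat.Combinatorics using (_C_)
open import Data.Integer using (ℤ; +_; -_; _+_; _-_; _*_; _≤_)
open import Data.Product using (_×_)

open import Data.Bool using (Bool; true; false; not; _∧_; T)
open import Data.Bool.Properties using (T-∧; T-≡; ∧-zeroʳ)
open import Data.Empty using (⊥-elim)
open import Data.Fin using (Fin; zero; suc; toℕ)
open import Data.Fin.Subset using (Subset; ∣_∣; ⁅_⁆; _∪_; _∈_; _∉_; inside; outside)
import Data.Fin.Subset as Subset
open import Data.Fin.Subset.Properties using (∣⁅x⁆∣≡1; ∪-identityˡ; ∪-identityʳ; p─⊥≡p)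
open import Data.Integer using (+≤+)
import Data.Integer.Properties as ℤ
open import Data.Integer.Tactic.RingSolver using (solve-∀)
open import Data.List using (List; []; _∷_; _++_; map; foldr; length; upTo; zipWith; allFin; filterᵇ)
open import Data.List.Membership.Propositional using (find; lose) renaming (_∈_ to _∈ₗ_)
open import Data.List.Membership.Propositional.Properties
  using (∈-++⁺ˡ; ∈-++⁺ʳ; ∈-map⁺; ∈-map⁻; ∈-filter⁺; ∈-filter⁻; ∈-length)
open import Data.List.Properties using (length-map; length-upTo; ∷-injective)
open import Data.List.Relation.Unary.All as All using (All)
open import Data.List.Relation.Unary.All.Properties using (concat⁺; map⁺; all-filter)
open import Data.List.Relation.Unary.Any using (here; there)
open import Data.List.Relation.Unary.Any.Properties using (any⁺; any⁻)
import Data.Nat as ℕ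
open import Data.Nat.Combinatorics using (nCk+nC[k+1]≡[n+1]C[k+1])
import Data.Nat.Properties as ℕ
open import Data.Product using (∃; _,_; proj₁; proj₂)
open import Data.Sum using (inj₁; inj₂)
open import Data.Vec using ([]; _∷_; here; there)
open import Function using (_∘_)
open import Function.Bundles using (Equivalence)
open import Relation.Binary.PropositionalEquality
open import Relation.Nullary using (contradiction)
open import Relation.Nullary.Decidable using (T?)

open Equivalence using (to; from)

∧-congˡ-under : ∀ {a b : Bool} c → (T c → a ≡ b) → a ∧ c ≡ b ∧ c
∧-congˡ-under         true  a≡b = cong (_∧ true) (a≡b _)
∧-congˡ-under {a} {b} false _   = trans (∧-zeroʳ a) (sym (∧-zeroʳ b))

countIn : ∀ {A : Set} → (A → Bool) → List A → ℕ
countIn P xs = length (boolFilter P xs)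

module _ {A : Set} where

  boolFilter≡filterᵇ : ∀ (P : A → Bool) xs → boolFilter P xs ≡ filterᵇ P xs
  boolFilter≡filterᵇ P [] = refl
  boolFilter≡filterᵇ P (x ∷ xs) with P x
  ... | true  = cong (x ∷_) (boolFilter≡filterᵇ P xs)
  ... | false = boolFilter≡filterᵇ P xs

  ∈-boolFilter⁺ : ∀ (P : A → Bool) {x xs} → x ∈ₗ xs → T (P x) → x ∈ₗ boolFilter P xs
  ∈-boolFilter⁺ P {xs = xs} x∈xs px =
    subst (_ ∈ₗ_) (sym (boolFilter≡filterᵇ P xs)) (∈-filter⁺ (T? ∘ P) x∈xs px)

  ∈-boolFilter⁻ : ∀ (P : A → Bool) {x} xs → x ∈ₗ boolFilter P xs → x ∈ₗ xs × T (P x)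
  ∈-boolFilter⁻ P xs x∈ = ∈-filter⁻ (T? ∘ P) (subst (_ ∈ₗ_) (boolFilter≡filterᵇ P xs) x∈)

  countIn-++ : ∀ (P : A → Bool) xs ys → countIn P (xs ++ ys) ≡ countIn P xs ℕ.+ countIn P ys
  countIn-++ P [] ys = refl
  countIn-++ P (x ∷ xs) ys with P x
  ... | true  = cong ℕ.suc (countIn-++ P xs ys)
  ... | false = countIn-++ P xs ys

  countIn-map : ∀ {B : Set} (P : B → Bool) (f : A → B) xs → countIn P (map f xs) ≡ countIn (P ∘ f) xs
  countIn-map P f [] = refl
  countIn-map P f (x ∷ xs) with P (f x)
  ... | true  = cong ℕ.suc (countIn-map P f xs)
  ... | false = countIn-map P f xs

  countIn-false : ∀ (xs : List A) → countIn (λ _ → false) xs ≡ 0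
  countIn-false [] = refl
  countIn-false (x ∷ xs) = countIn-false xs

  countIn-cong : ∀ {P Q : A → Bool} → (∀ x → P x ≡ Q x) → ∀ xs → countIn P xs ≡ countIn Q xs
  countIn-cong P≡Q [] = refl
  countIn-cong {Q = Q} P≡Q (x ∷ xs) rewrite P≡Q x with Q x
  ... | true  = cong ℕ.suc (countIn-cong P≡Q xs)
  ... | false = countIn-cong P≡Q xs

  countIn-split : ∀ (P Q : A → Bool) xs →
    countIn (λ x → not (P x) ∧ Q x) xs ℕ.+ countIn (λ x → P x ∧ Q x) xs ≡ countIn Q xs
  countIn-split P Q [] = refl
  countIn-split P Q (x ∷ xs) with P x | Q x
  ... | true  | true  = trans (ℕ.+-suc _ _) (cong ℕ.suc (countIn-split P Q xs))
  ... | false | true  = cong ℕ.suc (countIn-split P Q xs)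
  ... | true  | false = countIn-split P Q xs
  ... | false | false = countIn-split P Q xs

  countIn-mono : ∀ {P Q : A → Bool} → (∀ {x} → T (P x) → T (Q x)) →
    ∀ xs → countIn P xs ℕ.≤ countIn Q xs
  countIn-mono P⇒Q [] = ℕ.z≤n
  countIn-mono {P} {Q} P⇒Q (x ∷ xs) with P x | Q x | P⇒Q {x}
  ... | true  | true  | _   = ℕ.s≤s (countIn-mono P⇒Q xs)
  ... | true  | false | p⇒q = ⊥-elim (p⇒q _)
  ... | false | true  | _   = ℕ.m≤n⇒m≤1+n (countIn-mono P⇒Q xs)
  ... | false | false | _   = countIn-mono P⇒Q xs

  countIn-≡⇒⊇ : ∀ {P Q : A → Bool} → (∀ {x} → T (P x) → T (Q x)) →
    ∀ xs → countIn P xs ≡ countIn Q xs → ∀ {y} → y ∈ₗ xs → T (Q y) → T (P y)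
  countIn-≡⇒⊇ {P} {Q} P⇒Q (x ∷ xs) eq (here refl) qy with P x | Q x | P⇒Q {x}
  ... | true  | _     | _ = _
  ... | false | true  | _ = contradiction (ℕ.≤-reflexive (sym eq)) (ℕ.≤⇒≯ (countIn-mono P⇒Q xs))
  ... | false | false | _ = qy
  countIn-≡⇒⊇ {P} {Q} P⇒Q (x ∷ xs) eq (there y∈xs) qy with P x | Q x | P⇒Q {x}
  ... | true  | true  | _   = countIn-≡⇒⊇ P⇒Q xs (ℕ.suc-injective eq) y∈xs qy
  ... | true  | false | p⇒q = ⊥-elim (p⇒q _)
  ... | false | true  | _   = contradiction (ℕ.≤-reflexive (sym eq)) (ℕ.≤⇒≯ (countIn-mono P⇒Q xs))
  ... | false | false | _   = countIn-≡⇒⊇ P⇒Q xs eq y∈xs qy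

foldr-⊔-upper : ∀ {x xs} → x ∈ₗ xs → x ℕ.≤ foldr ℕ._⊔_ 0 xs
foldr-⊔-upper {xs = y ∷ ys} (here refl)  = ℕ.m≤m⊔n y _
foldr-⊔-upper {xs = y ∷ ys} (there x∈ys) = ℕ.≤-trans (foldr-⊔-upper x∈ys) (ℕ.m≤n⊔m y _)

foldr-⊔-attained : ∀ xs {k} → foldr ℕ._⊔_ 0 xs ≡ ℕ.suc k → ℕ.suc k ∈ₗ xs
foldr-⊔-attained (y ∷ ys) eq with ℕ.⊔-sel y (foldr ℕ._⊔_ 0 ys)
... | inj₁ ⊔≡y  = here (trans (sym eq) ⊔≡y)
... | inj₂ ⊔≡ys = there (foldr-⊔-attained ys (trans (sym ⊔≡ys) eq))

allSubsets-complete : ∀ {n} (p : Subset n) → p ∈ₗ allSubsets n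
allSubsets-complete {ℕ.zero} [] = here refl
allSubsets-complete {ℕ.suc n} (false ∷ p) = ∈-++⁺ˡ (∈-map⁺ (outside ∷_) (allSubsets-complete p))
allSubsets-complete {ℕ.suc n} (true ∷ p) =
  ∈-++⁺ʳ (map (outside ∷_) (allSubsets n)) (∈-map⁺ (inside ∷_) (allSubsets-complete p))

count-size≡C : ∀ n k → count (λ (F : Subset n) → ∣ F ∣ ℕ.≡ᵇ k) ≡ n C k
count-size≡C ℕ.zero ℕ.zero    = refl
count-size≡C ℕ.zero (ℕ.suc k) = refl
count-size≡C (ℕ.suc n) k = begin
  countIn (sized k) (map (outside ∷_) S ++ map (inside ∷_) S)
    ≡⟨ countIn-++ (sized k) (map (outside ∷_) S) (map (inside ∷_) S) ⟩
  countIn (sized k) (map (outside ∷_) S) ℕ.+ countIn (sized k) (map (inside ∷_) S)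
    ≡⟨ cong₂ ℕ._+_ (countIn-map (sized k) (outside ∷_) S) (countIn-map (sized k) (inside ∷_) S) ⟩
  countIn (sized k) S ℕ.+ countIn (λ p → ℕ.suc ∣ p ∣ ℕ.≡ᵇ k) S
    ≡⟨ pascal k ⟩
  ℕ.suc n C k ∎
  where
  open ≡-Reasoning
  S : List (Subset n)
  S = allSubsets n
  sized : ∀ {m} → ℕ → Subset m → Bool
  sized k F = ∣ F ∣ ℕ.≡ᵇ k
  pascal : ∀ k → countIn (sized k) S ℕ.+ countIn (λ p → ℕ.suc ∣ p ∣ ℕ.≡ᵇ k) S ≡ ℕ.suc n C k
  pascal ℕ.zero    = cong₂ ℕ._+_ (count-size≡C n 0) (countIn-false S)
  pascal (ℕ.suc k) = begin
    countIn (sized (ℕ.suc k)) S ℕ.+ countIn (sized k) S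
      ≡⟨ cong₂ ℕ._+_ (count-size≡C n (ℕ.suc k)) (count-size≡C n k) ⟩
    n C ℕ.suc k ℕ.+ n C k  ≡⟨ ℕ.+-comm (n C ℕ.suc k) (n C k) ⟩
    n C k ℕ.+ n C ℕ.suc k  ≡⟨ nCk+nC[k+1]≡[n+1]C[k+1] n k ⟩
    ℕ.suc n C ℕ.suc k      ∎

⊆ᵇ-refl : ∀ {n} (p : Subset n) → T (p ⊆ᵇ p)
⊆ᵇ-refl []          = _
⊆ᵇ-refl (true ∷ p)  = ⊆ᵇ-refl p
⊆ᵇ-refl (false ∷ p) = ⊆ᵇ-refl p

⊆ᵇ⇒∣∣≤ : ∀ {n} (p q : Subset n) → T (p ⊆ᵇ q) → ∣ p ∣ ℕ.≤ ∣ q ∣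
⊆ᵇ⇒∣∣≤ []          []          _   = ℕ.z≤n
⊆ᵇ⇒∣∣≤ (true ∷ p)  (true ∷ q)  p⊆q = ℕ.s≤s (⊆ᵇ⇒∣∣≤ p q p⊆q)
⊆ᵇ⇒∣∣≤ (false ∷ p) (true ∷ q)  p⊆q = ℕ.m≤n⇒m≤1+n (⊆ᵇ⇒∣∣≤ p q p⊆q)
⊆ᵇ⇒∣∣≤ (false ∷ p) (false ∷ q) p⊆q = ⊆ᵇ⇒∣∣≤ p q p⊆q

⊆ᵇ∧∣∣≡⇒≡ : ∀ {n} (p q : Subset n) → T (p ⊆ᵇ q) → ∣ p ∣ ≡ ∣ q ∣ → p ≡ q
⊆ᵇ∧∣∣≡⇒≡ []          []          _   _ = refl
⊆ᵇ∧∣∣≡⇒≡ (true ∷ p)  (true ∷ q)  p⊆q e = cong (true ∷_) (⊆ᵇ∧∣∣≡⇒≡ p q p⊆q (ℕ.suc-injective e))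
⊆ᵇ∧∣∣≡⇒≡ (false ∷ p) (false ∷ q) p⊆q e = cong (false ∷_) (⊆ᵇ∧∣∣≡⇒≡ p q p⊆q e)
⊆ᵇ∧∣∣≡⇒≡ (false ∷ p) (true ∷ q)  p⊆q e =
  contradiction (ℕ.≤-reflexive (sym e)) (ℕ.≤⇒≯ (⊆ᵇ⇒∣∣≤ p q p⊆q))

⊆ᵇ-cover : ∀ {n} (p q : Subset n) → T (p ⊆ᵇ q) → ∣ q ∣ ≡ ℕ.suc ∣ p ∣ →
  ∃ λ i → i ∉ p × i ∈ q × q ≡ p ∪ ⁅ i ⁆ × p ≡ q Subset.- i
⊆ᵇ-cover [] [] _ ()
⊆ᵇ-cover (true ∷ p) (true ∷ q) p⊆q e =
  let i , i∉p , i∈q , q≡ , p≡ = ⊆ᵇ-cover p q p⊆q (ℕ.suc-injective e)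
  in suc i , (λ { (there i∈p) → i∉p i∈p }) , there i∈q , cong (true ∷_) q≡ , cong (true ∷_) p≡
⊆ᵇ-cover (false ∷ p) (false ∷ q) p⊆q e =
  let i , i∉p , i∈q , q≡ , p≡ = ⊆ᵇ-cover p q p⊆q e
  in suc i , (λ { (there i∈p) → i∉p i∈p }) , there i∈q , cong (false ∷_) q≡ , cong (false ∷_) p≡
⊆ᵇ-cover (false ∷ p) (true ∷ q) p⊆q e =
  zero , (λ ()) , here ,
  cong (true ∷_) (trans (sym p≡q) (sym (∪-identityʳ p))) ,
  cong (false ∷_) (trans p≡q (sym (p─⊥≡p q)))
  where
  p≡q : p ≡ q
  p≡q = ⊆ᵇ∧∣∣≡⇒≡ p q p⊆q (sym (ℕ.suc-injective e))

∣⁅i⁆∪⁅j⁆∣≡2 : ∀ {n} (i j : Fin n) → i ≢ j → ∣ ⁅ i ⁆ ∪ ⁅ j ⁆ ∣ ≡ 2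
∣⁅i⁆∪⁅j⁆∣≡2 zero    zero    i≢j = contradiction refl i≢j
∣⁅i⁆∪⁅j⁆∣≡2 zero    (suc j) _   = cong ℕ.suc (trans (cong ∣_∣ (∪-identityˡ ⁅ j ⁆)) (∣⁅x⁆∣≡1 j))
∣⁅i⁆∪⁅j⁆∣≡2 (suc i) zero    _   = cong ℕ.suc (trans (cong ∣_∣ (∪-identityʳ ⁅ i ⁆)) (∣⁅x⁆∣≡1 i))
∣⁅i⁆∪⁅j⁆∣≡2 (suc i) (suc j) i≢j = ∣⁅i⁆∪⁅j⁆∣≡2 i j (i≢j ∘ cong suc)

module _ {n : ℕ} (Δ : Complex n) where

  maxFaceSize-upper : ∀ {F} → T (Δ F) → ∣ F ∣ ℕ.≤ maxFaceSize Δ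
  maxFaceSize-upper {F} ΔF =
    foldr-⊔-upper (∈-map⁺ ∣_∣ (∈-boolFilter⁺ Δ (allSubsets-complete F) ΔF))

  maxFaceSize-attained : ∀ {k} → maxFaceSize Δ ≡ ℕ.suc k → ∃ λ F → T (Δ F) × ∣ F ∣ ≡ ℕ.suc k
  maxFaceSize-attained eq =
    let F , F∈ , k≡∣F∣ = ∈-map⁻ ∣_∣ (foldr-⊔-attained _ eq)
        _ , ΔF = ∈-boolFilter⁻ Δ (allSubsets n) F∈
    in F , ΔF , sym k≡∣F∣

  fᵢ-positive : ∀ {F i} → T (Δ F) → ∣ F ∣ ≡ ℕ.suc i → 0 ℕ.< fᵢ Δ i
  fᵢ-positive {F} ΔF ∣F∣≡ =
    ∈-length (∈-boolFilter⁺ _ (allSubsets-complete F) (from T-∧ (ΔF , ℕ.≡⇒≡ᵇ _ _ ∣F∣≡)))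

  fVector-length : length (fVector Δ) ≡ maxFaceSize Δ
  fVector-length = trans (length-map _ (upTo (maxFaceSize Δ))) (length-upTo _)

  fVector-of-dim1 : maxFaceSize Δ ≡ 2 → fVector Δ ≡ + fᵢ Δ 0 ∷ + fᵢ Δ 1 ∷ []
  fVector-of-dim1 eq = cong (λ s → map (λ i → + fᵢ Δ i) (upTo s)) eq

fᵢ-≡⇒⊇ : ∀ {n} (Δ Δ′ : Complex n) {i} → (∀ {F} → ∣ F ∣ ≡ ℕ.suc i → T (Δ F) → T (Δ′ F)) →
  fᵢ Δ i ≡ fᵢ Δ′ i → ∀ F → ∣ F ∣ ≡ ℕ.suc i → T (Δ′ F) → T (Δ F)
fᵢ-≡⇒⊇ {n} Δ Δ′ {i} Δ⊆Δ′ f≡ F ∣F∣≡ Δ′F =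
  proj₁ (to T-∧ (countIn-≡⇒⊇ restrict (allSubsets n) f≡ (allSubsets-complete F)
                              (from T-∧ (Δ′F , ℕ.≡⇒≡ᵇ _ _ ∣F∣≡))))
  where
  restrict : ∀ {G} → T (Δ G ∧ (∣ G ∣ ℕ.≡ᵇ ℕ.suc i)) → T (Δ′ G ∧ (∣ G ∣ ℕ.≡ᵇ ℕ.suc i))
  restrict t = let ΔG , sized = to T-∧ t in from T-∧ (Δ⊆Δ′ (ℕ.≡ᵇ⇒≡ _ _ sized) ΔG , sized)

module Ideal {n : ℕ} (gens : List (Subset n)) where

  δF δN : Complex n
  δF = facetComplex gens
  δN = nonFaceComplex gens

  inIdeal⁺ : ∀ {g F} → g ∈ₗ gens → T (g ⊆ᵇ F) → T (inIdeal gens F)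
  inIdeal⁺ g∈ g⊆F = any⁺ _ (lose g∈ g⊆F)

  inIdeal⁻ : ∀ F → T (inIdeal gens F) → ∃ λ g → g ∈ₗ gens × T (g ⊆ᵇ F)
  inIdeal⁻ _ t = find (any⁻ _ gens t)

  facet⁺ : ∀ {g F} → g ∈ₗ gens → T (F ⊆ᵇ g) → T (δF F)
  facet⁺ g∈ F⊆g = any⁺ _ (lose g∈ F⊆g)

  facet⁻ : ∀ F → T (δF F) → ∃ λ g → g ∈ₗ gens × T (F ⊆ᵇ g)
  facet⁻ _ t = find (any⁻ _ gens t)

  inIdeal-aboveDim : ∀ {F} → maxFaceSize δN ℕ.< ∣ F ∣ → T (inIdeal gens F)
  inIdeal-aboveDim {F} max<∣F∣ with inIdeal gens F | maxFaceSize-upper δN {F}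
  ... | true  | _     = _
  ... | false | upper = contradiction (upper _) (ℕ.<⇒≱ max<∣F∣)

  quasiFType0-fVectors : ∀ {b} → IsQuasiFIdealOfType gens (+ 0 ∷ b ∷ []) →
    maxFaceSize δN ≡ 2 × fᵢ δN 0 ≡ fᵢ δF 0 × b ≡ + fᵢ δN 1 - + fᵢ δF 1
  quasiFType0-fVectors (lengthN , lengthF , difference) =
    dimN , ℤ.+-injective (ℤ.i-j≡0⇒i≡j _ _ f₀-diff) , sym f₁-diff
    where
    dimN : maxFaceSize δN ≡ 2
    dimN = trans (sym (fVector-length δN)) lengthN
    dimF : maxFaceSize δF ≡ 2
    dimF = trans (sym (fVector-length δF)) lengthF
    entrywise : (+ fᵢ δN 0 - + fᵢ δF 0) ∷ (+ fᵢ δN 1 - + fᵢ δF 1) ∷ [] ≡ + 0 ∷ _ ∷ []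
    entrywise = subst₂ (λ u v → zipWith _-_ u v ≡ _)
                       (fVector-of-dim1 δN dimN) (fVector-of-dim1 δF dimF) difference
    f₀-diff : + fᵢ δN 0 - + fᵢ δF 0 ≡ + 0
    f₀-diff = proj₁ (∷-injective entrywise)
    f₁-diff : + fᵢ δN 1 - + fᵢ δF 1 ≡ _
    f₁-diff = proj₁ (∷-injective (proj₂ (∷-injective entrywise)))

  module Equigenerated {k : ℕ} (gens-degree : All (λ g → ∣ g ∣ ≡ ℕ.suc k) gens) where

    generator-degree : ∀ {g} → g ∈ₗ gens → ∣ g ∣ ≡ ℕ.suc k
    generator-degree = All.lookup gens-degree

    facet⇒inIdeal : ∀ {F} → ∣ F ∣ ≡ ℕ.suc k → T (δF F) → T (inIdeal gens F)
    facet⇒inIdeal {F} ∣F∣≡ isFacet =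
      let g , g∈ , F⊆g = facet⁻ F isFacet
          F≡g = ⊆ᵇ∧∣∣≡⇒≡ F g F⊆g (trans ∣F∣≡ (sym (generator-degree g∈)))
      in inIdeal⁺ g∈ (subst (λ G → T (G ⊆ᵇ F)) F≡g (⊆ᵇ-refl F))

    inIdeal⇒facet : ∀ {F} → ∣ F ∣ ≡ ℕ.suc k → T (inIdeal gens F) → T (δF F)
    inIdeal⇒facet {F} ∣F∣≡ inI =
      let g , g∈ , g⊆F = inIdeal⁻ F inI
          g≡F = ⊆ᵇ∧∣∣≡⇒≡ g F g⊆F (trans (generator-degree g∈) (sym ∣F∣≡))
      in facet⁺ {F = F} g∈ (subst (λ G → T (F ⊆ᵇ G)) (sym g≡F) (⊆ᵇ-refl F))

    facet≡inIdeal : ∀ {F} → ∣ F ∣ ≡ ℕ.suc k → δF F ≡ inIdeal gens F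
    facet≡inIdeal {F} ∣F∣≡ with δF F in isFacet | inIdeal gens F in inI
    ... | true  | true  = refl
    ... | false | false = refl
    ... | true  | false = contradiction (facet⇒inIdeal ∣F∣≡ (subst T (sym isFacet) _)) (subst T inI)
    ... | false | true  = contradiction (inIdeal⇒facet ∣F∣≡ (subst T (sym inI) _)) (subst T isFacet)

    nonFace-belowDegree : ∀ F → ∣ F ∣ ℕ.≤ k → T (δN F)
    nonFace-belowDegree F ∣F∣≤k with inIdeal gens F in inI
    ... | false = _
    ... | true  =
      let g , g∈ , g⊆F = inIdeal⁻ F (subst T (sym inI) _)
      in contradiction (subst (ℕ._≤ ∣ F ∣) (generator-degree g∈) (⊆ᵇ⇒∣∣≤ g F g⊆F)) (ℕ.≤⇒≯ ∣F∣≤k)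

    -- G(I) as an element of sm(R)_{k+1}: the faces of δ_F of size k+1 are exactly the generators.
    generators : SMSet n (ℕ.suc k)
    generators = record
      { mem    = λ F → δF F ∧ (∣ F ∣ ℕ.≡ᵇ ℕ.suc k)
      ; degree = λ F e → ℕ.≡ᵇ⇒≡ _ _ (proj₂ (to T-∧ (from T-≡ e)))
      }

    generator∈generators : ∀ {g} → g ∈ₗ gens → mem generators g ≡ true
    generator∈generators {g} g∈ =
      to T-≡ (from T-∧ (facet⁺ {F = g} g∈ (⊆ᵇ-refl g) , ℕ.≡⇒≡ᵇ _ _ (generator-degree g∈)))

    generators-upperPerfect : (∀ F → ∣ F ∣ ≡ ℕ.suc (ℕ.suc k) → T (inIdeal gens F)) →
      UpperPerfect generators
    generators-upperPerfect inI F ∣F∣≡ =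
      let g , g∈ , g⊆F = inIdeal⁻ F (inI F ∣F∣≡)
          i , i∉g , _ , F≡ , _ =
            ⊆ᵇ-cover g F g⊆F (trans ∣F∣≡ (cong ℕ.suc (sym (generator-degree g∈))))
      in g , i , generator∈generators g∈ , i∉g , F≡

    generators-lowerPerfect : (∀ F → ∣ F ∣ ≡ k → T (δF F)) → LowerPerfect generators
    generators-lowerPerfect inδF F ∣F∣+1≡ =
      let ∣F∣≡ = ℕ.suc-injective (trans (ℕ.+-comm 1 ∣ F ∣) ∣F∣+1≡)
          g , g∈ , F⊆g = facet⁻ F (inδF F ∣F∣≡)
          i , _ , i∈g , _ , F≡ =
            ⊆ᵇ-cover F g F⊆g (trans (generator-degree g∈) (cong ℕ.suc (sym ∣F∣≡)))
      in g , i , generator∈generators g∈ , i∈g , F≡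

    f-sum : fᵢ δN k ℕ.+ fᵢ δF k ≡ n C ℕ.suc k
    f-sum = begin
      fᵢ δN k ℕ.+ fᵢ δF k
        ≡⟨ cong (fᵢ δN k ℕ.+_) (countIn-cong sized-facet≡sized-inIdeal S) ⟩
      countIn (λ F → not (inIdeal gens F) ∧ sized F) S ℕ.+ countIn (λ F → inIdeal gens F ∧ sized F) S
        ≡⟨ countIn-split (inIdeal gens) sized S ⟩
      count sized
        ≡⟨ count-size≡C n (ℕ.suc k) ⟩
      n C ℕ.suc k ∎
      where
      open ≡-Reasoning
      S : List (Subset n)
      S = allSubsets n
      sized : Subset n → Bool
      sized F = ∣ F ∣ ℕ.≡ᵇ ℕ.suc k
      sized-facet≡sized-inIdeal : ∀ F → δF F ∧ sized F ≡ inIdeal gens F ∧ sized F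
      sized-facet≡sized-inIdeal F = ∧-congˡ-under (sized F) (facet≡inIdeal ∘ ℕ.≡ᵇ⇒≡ _ _)

edgeGens-degree : ∀ {n} (G : Graph n) → All (λ g → ∣ g ∣ ≡ 2) (edgeGens G)
edgeGens-degree {n} G = concat⁺ (map⁺ (All.universal edgesAt-degree (allFin n)))
  where
  edgesAt-degree : ∀ i → All (λ g → ∣ g ∣ ≡ 2)
    (map (λ j → ⁅ i ⁆ ∪ ⁅ j ⁆) (boolFilter (λ j → adj G i j ∧ (toℕ i ℕ.<ᵇ toℕ j)) (allFin n)))
  edgesAt-degree i =
    map⁺ (All.map (λ {j} edge∧i<j → ∣⁅i⁆∪⁅j⁆∣≡2 i j (i<j⇒i≢j (proj₂ (to T-∧ edge∧i<j))))
                  (subst (All _) (sym (boolFilter≡filterᵇ _ (allFin n))) (all-filter _ (allFin n))))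
    where
    i<j⇒i≢j : ∀ {j} → T (toℕ i ℕ.<ᵇ toℕ j) → i ≢ j
    i<j⇒i≢j {j} i<j = ℕ.<⇒≢ (ℕ.<ᵇ⇒< (toℕ i) (toℕ j) i<j) ∘ cong toℕ

difference-bounds : ∀ {a c m} → 0 ℕ.< a → m ℕ.≤ c →
  (- (+ (a ℕ.+ c)) + + 2 ≤ + a - + c) × (+ a - + c ≤ + (a ℕ.+ c) - + 2 * + m)
difference-bounds {a} {c} {m} 0<a m≤c rewrite ℤ.pos-+ a c = lower , upper
  where
  open ℤ.≤-Reasoning
  lower : - (+ a + + c) + + 2 ≤ + a - + c
  lower = begin
    - (+ a + + c) + + 2        ≤⟨ ℤ.+-monoʳ-≤ (- (+ a + + c)) (ℤ.+-mono-≤ (+≤+ 0<a) (+≤+ 0<a)) ⟩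
    - (+ a + + c) + (+ a + + a) ≡⟨ eq (+ a) (+ c) ⟩
    + a - + c                  ∎
    where
    eq : ∀ x y → - (x + y) + (x + x) ≡ x - y
    eq = solve-∀
  upper : + a - + c ≤ (+ a + + c) - + 2 * + m
  upper = begin
    + a - + c                  ≡⟨ eq₁ (+ a) (+ c) ⟩
    (+ a + + c) - (+ c + + c)  ≤⟨ ℤ.+-monoʳ-≤ (+ a + + c) (ℤ.neg-mono-≤ (ℤ.+-mono-≤ (+≤+ m≤c) (+≤+ m≤c))) ⟩
    (+ a + + c) - (+ m + + m)  ≡⟨ eq₂ (+ a + + c) (+ m) ⟩
    (+ a + + c) - + 2 * + m    ∎
    where
    eq₁ : ∀ x y → x - y ≡ (x + y) - (y + y)
    eq₁ = solve-∀
    eq₂ : ∀ x z → x - (z + z) ≡ x - + 2 * z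
    eq₂ = solve-∀

quasiFIdeal-bounds : ∀ {n} (gens : List (Subset n)) → All (λ g → ∣ g ∣ ≡ 2) gens →
  ∀ {b} → IsQuasiFIdealOfType gens (+ 0 ∷ b ∷ []) → ∀ {m} → IsN n 2 m →
  (- (+ (n C 2)) + + 2 ≤ b) × (b ≤ + (n C 2) - + 2 * + m)
quasiFIdeal-bounds {n} gens degree quasiF {m} (_ , minimal)
  with Ideal.quasiFType0-fVectors gens quasiF
... | dimN , f₀≡ , b≡ =
  subst₂ bounds f-sum (sym b≡) (difference-bounds nonFace-edge (minimal generators (upper , lower)))
  where
  open Ideal gens
  open Equigenerated degree
  bounds : ℕ → ℤ → Set
  bounds N b = (- (+ N) + + 2 ≤ b) × (b ≤ + N - + 2 * + m)
  nonFace-edge : 0 ℕ.< fᵢ δN 1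
  nonFace-edge = let F , δN-F , ∣F∣≡2 = maxFaceSize-attained δN dimN in fᵢ-positive δN δN-F ∣F∣≡2
  upper : UpperPerfect generators
  upper = generators-upperPerfect λ F ∣F∣≡3 →
    inIdeal-aboveDim (subst (ℕ._< ∣ F ∣) (sym dimN) (ℕ.≤-reflexive (sym ∣F∣≡3)))
  nonFace-singleton : ∀ F → ∣ F ∣ ≡ 1 → T (δN F)
  nonFace-singleton F ∣F∣≡1 = nonFace-belowDegree F (ℕ.≤-reflexive ∣F∣≡1)
  lower : LowerPerfect generators
  lower = generators-lowerPerfect λ F ∣F∣≡1 →
    fᵢ-≡⇒⊇ δF δN (λ {G} ∣G∣≡1 _ → nonFace-singleton G ∣G∣≡1) (sym f₀≡) F ∣F∣≡1 (nonFace-singleton F ∣F∣≡1)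

corollary3p3 : (n : ℕ) (G : Graph n) (b : ℤ) → IsQuasiFGraphOfType0 G b →
    (m : ℕ) → IsN n 2 m →
    (- (+ (n C 2)) + + 2 ≤ b) × (b ≤ + (n C 2) - + 2 * + m)
corollary3p3 n G b quasiF m = quasiFIdeal-bounds (edgeGens G) (edgeGens-degree G) quasiF
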